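{- Let $R$ be a convergent forward-closed string rewriting system over a finite alphabet $\Sigma$, and let $x, y \in IRR(R)$ with $y \neq \lambda$ and $xy \to_R^! x$. Let $y_1$ be a prefix of $y$. Then $x y_1$ causes a subterm-collapse, i.e. there is a non-empty string $w$ with $x y_1 w \to_R^* x y_1$.
   Context: A string rewriting system $R$ over $\Sigma$ is a set of rules $l\to r$ ($l,r\in\Sigma^*$) with rewrite relation $xly\to_R xry$; $IRR(R)$ is the set of irreducible strings; $w\to_R^! w'$ means $w\to_R^* w'$ with $w'$ irreducible; $\lambda$ is the empty string. $R$ is convergent if terminating and confluent. An innermost redex is a string $wl$ ($l$ a left-hand side) no proper prefix of which is a redex $w'l'$; $R$ is forward-closed if every innermost redex reduces to its normal form in one step. A string $x$ causes a subterm-collapse iff there is a non-empty string $y$ with $xy \to_R^* x$. -}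

module Defs where

open import Data.Nat using (ℕ)
open import Data.Fin using (Fin)
open import Data.List using (List; []; _∷_; _++_)
open import Data.Product using (Σ; ∃; ∃-syntax; _×_; _,_)
open import Relation.Nullary using (¬_)
open import Relation.Binary.PropositionalEquality using (_≡_)
open import Relation.Binary.Construct.Closure.ReflexiveTransitive using (Star)
open import Induction.WellFounded using (WellFounded)
open import Level using (0ℓ; suc)

Word : ℕ → Set
Word k = List (Fin k)

SRS : ℕ → Set₁
SRS k = Word k → Word k → Set

module _ {k : ℕ} (R : SRS k) where

  data _⟶_ : Word k → Word k → Set where
    rw : ∀ x l r y → R l r → (x ++ l ++ y) ⟶ (x ++ r ++ y)

  _⟶*_ : Word k → Word k → Set
  _⟶*_ = Star _⟶_

  Irreducible : Word k → Set
  Irreducible w = ∀ w′ → ¬ (w ⟶ w′)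

  _⟶!_ : Word k → Word k → Set
  w ⟶! w′ = (w ⟶* w′) × Irreducible w′

  Terminating : Set
  Terminating = WellFounded (λ b a → a ⟶ b)

  Confluent : Set
  Confluent = ∀ {a b c} → a ⟶* b → a ⟶* c → ∃[ d ] ((b ⟶* d) × (c ⟶* d))

  Convergent : Set
  Convergent = Terminating × Confluent

  IsRedex : Word k → Set
  IsRedex u = ∃[ w ] ∃[ l ] ∃[ r ] (R l r × u ≡ w ++ l)

  ProperPrefix : Word k → Word k → Set
  ProperPrefix u v = ∃[ s ] (¬ (s ≡ []) × v ≡ u ++ s)

  InnermostRedex : Word k → Set
  InnermostRedex u = IsRedex u × (∀ p → ProperPrefix p u → ¬ IsRedex p)

  ForwardClosed : Set
  ForwardClosed = ∀ u v → InnermostRedex u → u ⟶! v → u ⟶ v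

  CausesSubtermCollapse : Word k → Set
  CausesSubtermCollapse x = ∃[ y ] (¬ (y ≡ []) × ((x ++ y) ⟶* x))

-- Pushing the y₂-part of y = y₁ y₂ to the end: appending y₁ to the reduction
-- x y₁ y₂ →* x gives x y₁ (y₂ y₁) →* x y₁, and y₂ y₁ is non-empty because y is.
module Submission where

open import Defs
open import Data.Nat using (ℕ)
open import Data.List using ([]; _++_)
open import Data.List.Properties using (++-assoc; ++-conicalˡ; ++-conicalʳ)
open import Data.Product using (_,_; proj₁)
open import Relation.Nullary using (¬_)
open import Relation.Binary.PropositionalEquality using (_≡_; refl; subst₂; subst; sym; cong; module ≡-Reasoning)
open import Relation.Binary.Construct.Closure.ReflexiveTransitive using (gmap)

module _ {k : ℕ} (R : SRS k) where

  ⟶-++ʳ : ∀ {a b} (c : Word k) → _⟶_ R a b → _⟶_ R (a ++ c) (b ++ c)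
  ⟶-++ʳ c (rw x l r y p) = subst₂ (_⟶_ R) (reassoc l) (reassoc r) (rw x l r (y ++ c) p)
    where
    reassoc : ∀ u → x ++ u ++ y ++ c ≡ (x ++ u ++ y) ++ c
    reassoc u = sym (begin
      (x ++ u ++ y) ++ c   ≡⟨ ++-assoc x (u ++ y) c ⟩
      x ++ (u ++ y) ++ c   ≡⟨ cong (x ++_) (++-assoc u y c) ⟩
      x ++ u ++ y ++ c     ∎)
      where open ≡-Reasoning

  ⟶*-++ʳ : ∀ {a b} (c : Word k) → _⟶*_ R a b → _⟶*_ R (a ++ c) (b ++ c)
  ⟶*-++ʳ c = gmap (_++ c) (⟶-++ʳ c)

  ++-swap-nonempty : ∀ (u v : Word k) → ¬ (u ++ v ≡ []) → ¬ (v ++ u ≡ [])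
  ++-swap-nonempty u v u++v≢[] v++u≡[]
    with refl ← ++-conicalˡ v u v++u≡[] | refl ← ++-conicalʳ v u v++u≡[] = u++v≢[] refl

  prefix-causesSubtermCollapse : ∀ x (y₁ y₂ : Word k) → ¬ (y₁ ++ y₂ ≡ []) →
                                 _⟶*_ R (x ++ y₁ ++ y₂) x →
                                 CausesSubtermCollapse R (x ++ y₁)
  prefix-causesSubtermCollapse x y₁ y₂ y≢[] xy⟶*x =
    y₂ ++ y₁ , ++-swap-nonempty y₁ y₂ y≢[] ,
    subst (λ u → _⟶*_ R u (x ++ y₁)) reassoc (⟶*-++ʳ y₁ xy⟶*x)
    where
    reassoc : (x ++ y₁ ++ y₂) ++ y₁ ≡ (x ++ y₁) ++ y₂ ++ y₁
    reassoc = begin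
      (x ++ y₁ ++ y₂) ++ y₁    ≡⟨ ++-assoc x (y₁ ++ y₂) y₁ ⟩
      x ++ (y₁ ++ y₂) ++ y₁    ≡⟨ cong (x ++_) (++-assoc y₁ y₂ y₁) ⟩
      x ++ y₁ ++ y₂ ++ y₁      ≡⟨ ++-assoc x y₁ (y₂ ++ y₁) ⟨
      (x ++ y₁) ++ y₂ ++ y₁    ∎
      where open ≡-Reasoning

lemma5 : (k : ℕ) (R : SRS k) → Convergent R → ForwardClosed R →
    (x y : Word k) → Irreducible R x → Irreducible R y → ¬ (y ≡ []) →
    _⟶!_ R (x ++ y) x →
    (y₁ y₂ : Word k) → y ≡ y₁ ++ y₂ →
    CausesSubtermCollapse R (x ++ y₁)
lemma5 k R _ _ x y _ _ y≢[] xy⟶!x y₁ y₂ refl =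
  prefix-causesSubtermCollapse R x y₁ y₂ y≢[] (proj₁ xy⟶!x)
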